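{- Let $\phi$ be a Gallai coloring of $K_6$ using exactly three colors such that there is a matching of three edges colored with exactly two of the colors, and all remaining edges are colored with the third color. Then $w(\phi)=53$.
   Context: A Gallai coloring of $K_m$ is a coloring $E(K_m)\to\{\text{red},\text{green},\text{blue}\}$ with no rainbow triangle (triangle whose three edges have three distinct colors). For a Gallai coloring $\psi$ of $K_m$, regard $K_{m+1}$ as $K_m$ plus a new vertex $u$; $w(\psi)$ is the number of colorings of the edges from $u$ to $V(K_m)$ with colors in $\{\text{red},\text{green},\text{blue}\}$ such that the resulting coloring of $E(K_{m+1})$ is Gallai. -}

module Defs where

open import Data.Nat using (ℕ; zero; suc)
open import Data.Fin using (Fin; zero; suc)
open import Data.Fin.Properties using (all?)
open import Data.List using (List; []; _∷_; [_]; map; concatMap; filter; length)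
open import Data.Vec.Functional as VF using ()
open import Data.Product using (Σ; _×_; _,_; ∃)
open import Data.Sum using (_⊎_)
open import Relation.Nullary using (¬_; Dec; yes; no)
open import Relation.Nullary.Decidable using (¬?; _×-dec_; _→-dec_)
open import Relation.Binary.PropositionalEquality using (_≡_; _≢_; refl)
open import Relation.Binary using (DecidableEquality)
open import Data.Fin using () renaming (_≟_ to _≟ᶠ_)

data Color : Set where
  red green blue : Color

_≟ᶜ_ : DecidableEquality Color
red   ≟ᶜ red   = yes refl
red   ≟ᶜ green = no λ ()
red   ≟ᶜ blue  = no λ ()
green ≟ᶜ red   = no λ ()
green ≟ᶜ green = yes refl
green ≟ᶜ blue  = no λ ()
blue  ≟ᶜ red   = no λ ()
blue  ≟ᶜ green = no λ ()
blue  ≟ᶜ blue  = yes refl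

allColors : List Color
allColors = red ∷ green ∷ blue ∷ []

-- An edge coloring of K_m: the color of edge {i,j} (i ≢ j) is c i j.
-- Diagonal values c i i are irrelevant. Symmetry is a separate hypothesis.
Coloring : ℕ → Set
Coloring m = Fin m → Fin m → Color

Symmetric : ∀ {m} → Coloring m → Set
Symmetric {m} c = ∀ (i j : Fin m) → i ≢ j → c i j ≡ c j i

Rainbow : Color → Color → Color → Set
Rainbow x y z = x ≢ y × y ≢ z × x ≢ z

rainbow? : ∀ x y z → Dec (Rainbow x y z)
rainbow? x y z = ¬? (x ≟ᶜ y) ×-dec ¬? (y ≟ᶜ z) ×-dec ¬? (x ≟ᶜ z)

IsGallai : ∀ {m} → Coloring m → Set
IsGallai {m} c = ∀ (i j k : Fin m) → i ≢ j → j ≢ k → i ≢ k →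
                 ¬ Rainbow (c i j) (c j k) (c i k)

isGallai? : ∀ {m} (c : Coloring m) → Dec (IsGallai c)
isGallai? c =
  all? λ i → all? λ j → all? λ k →
    ¬? (i ≟ᶠ j) →-dec (¬? (j ≟ᶠ k) →-dec (¬? (i ≟ᶠ k) →-dec
      ¬? (rainbow? (c i j) (c j k) (c i k))))

UsesAllThreeColors : ∀ {m} → Coloring m → Set
UsesAllThreeColors {m} c = ∀ (x : Color) → Σ (Fin m) λ i → Σ (Fin m) λ j → i ≢ j × c i j ≡ x

-- K_{m+1} = K_m plus a new vertex u = zero; f gives the colors of the edges u–v.
extend : ∀ {m} → Coloring m → (Fin m → Color) → Coloring (suc m)
extend c f zero    zero    = red   -- diagonal, irrelevant
extend c f zero    (suc j) = f j
extend c f (suc i) zero    = f i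
extend c f (suc i) (suc j) = c i j

-- All 3^m functions Fin m → Color, each exactly once.
allFuns : (m : ℕ) → List (Fin m → Color)
allFuns zero    = [ (λ ()) ]
allFuns (suc m) = concatMap (λ f → map (λ x → x VF.∷ f) allColors) (allFuns m)

w : ∀ {m} → Coloring m → ℕ
w {m} c = length (filter (λ f → isGallai? (extend c f)) (allFuns m))

-- Matching of three edges {a k, b k} (k : Fin 3) in K_6: all six endpoints distinct.
record Matching3 : Set where
  field
    a b   : Fin 3 → Fin 6
    a-inj : ∀ k l → a k ≡ a l → k ≡ l
    b-inj : ∀ k l → b k ≡ b l → k ≡ l
    a≢b   : ∀ k l → a k ≢ b l

InMatching : Matching3 → Fin 6 → Fin 6 → Set
InMatching M i j = Σ (Fin 3) λ k → (i ≡ a k × j ≡ b k) ⊎ (i ≡ b k × j ≡ a k)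
  where open Matching3 M

MatchingColoring : Coloring 6 → Set
MatchingColoring φ =
  Σ Matching3 λ M → Σ Color λ α → Σ Color λ β → Σ Color λ γ →
    let open Matching3 M in
    Rainbow α β γ
    × (∀ k → φ (a k) (b k) ≡ α ⊎ φ (a k) (b k) ≡ β)
    × (∃ λ k → φ (a k) (b k) ≡ α)
    × (∃ λ k → φ (a k) (b k) ≡ β)
    × (∀ i j → i ≢ j → ¬ InMatching M i j → φ i j ≡ γ)

module Submission where

open import Defs
open import Data.Nat using (ℕ; zero; suc; _+_; _*_) renaming (_≟_ to _≟ⁿ_)
open import Data.Nat.Properties using (+-assoc; +-commutativeSemigroup; *-identityˡ; *-distribʳ-+; n<1+n)
open import Algebra.Properties.CommutativeSemigroup +-commutativeSemigroup using (interchange)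
open import Data.Fin using (Fin; zero; suc; lift; punchOut; combine) renaming (_≟_ to _≟ᶠ_)
open import Data.Fin.Properties using (all?; any?; pigeonhole; punchOut-injective; <⇒≢; lift-injective)
open import Data.List using (List; []; _∷_; map; concatMap; filter; length; _++_)
open import Data.Vec.Functional using () renaming ([] to []ᵛ; _∷_ to _∷ᵛ_)
open import Data.Bool using (true; false; if_then_else_)
open import Data.Product using (_×_; _,_; ∃; ∃₂; proj₁; proj₂; uncurry)
open import Data.Sum using (inj₁; inj₂)
open import Data.Empty using (⊥-elim)
open import Function using (_∘_; id; _on_)
open import Function.Definitions using (Injective)
open import Relation.Nullary using (¬_; Dec; yes; no; does; proof)
open import Relation.Nullary.Reflects using (invert)
open import Relation.Nullary.Decidable using (¬?; _×-dec_; _→-dec_; map′)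
open import Relation.Binary.Core using (_Preserves_⟶_)
open import Relation.Binary.PropositionalEquality

-- Relabelling the vertices of K₆ moves the matching to {0,1}, {2,3}, {4,5}.  Relabelling
-- the vertices of K_m permutes the 3^m ways of colouring the edges at the new vertex and
-- preserves Gallai-ness, so it does not change w (a double-counting argument over the
-- list of all colourings).  After relabelling, the colouring is determined by the colours
-- of the three matching edges and of the rest, and w = 53 is checked by evaluation for
-- each admissible choice.

-- Indicators and sums over lists

𝟙 : ∀ {P : Set} → Dec P → ℕ
𝟙 P? = if does P? then 1 else 0

𝟙-⇔ : ∀ {P Q : Set} (P? : Dec P) (Q? : Dec Q) → (P → Q) → (Q → P) → 𝟙 P? ≡ 𝟙 Q?
𝟙-⇔ (yes p) (yes q) to from = refl
𝟙-⇔ (yes p) (no ¬q) to from = ⊥-elim (¬q (to p))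
𝟙-⇔ (no ¬p) (yes q) to from = ⊥-elim (¬p (from q))
𝟙-⇔ (no ¬p) (no ¬q) to from = refl

𝟙-×-dec : ∀ {P Q : Set} (P? : Dec P) (Q? : Dec Q) → 𝟙 (P? ×-dec Q?) ≡ 𝟙 P? * 𝟙 Q?
𝟙-×-dec (yes p) (yes q) = refl
𝟙-×-dec (yes p) (no ¬q) = refl
𝟙-×-dec (no ¬p) Q?      = refl

𝟙-*-cong : ∀ {P : Set} (P? : Dec P) {m n : ℕ} → (P → m ≡ n) → 𝟙 P? * m ≡ 𝟙 P? * n
𝟙-*-cong (yes p) m≡n = cong (1 *_) (m≡n p)
𝟙-*-cong (no ¬p) m≡n = refl

∑ : ∀ {A : Set} → List A → (A → ℕ) → ℕ
∑ []       g = 0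
∑ (x ∷ xs) g = g x + ∑ xs g

syntax ∑ xs (λ x → g) = ∑[ x ∈ xs ] g

module _ {A : Set} where

  ∑-cong : ∀ (xs : List A) {g h : A → ℕ} → g ≗ h → ∑ xs g ≡ ∑ xs h
  ∑-cong []       g≗h = refl
  ∑-cong (x ∷ xs) g≗h = cong₂ _+_ (g≗h x) (∑-cong xs g≗h)

  ∑-zero : ∀ (xs : List A) → ∑[ x ∈ xs ] 0 ≡ 0
  ∑-zero []       = refl
  ∑-zero (x ∷ xs) = ∑-zero xs

  ∑-distrib-+ : ∀ (xs : List A) (g h : A → ℕ) → ∑[ x ∈ xs ] (g x + h x) ≡ ∑ xs g + ∑ xs h
  ∑-distrib-+ []       g h = refl
  ∑-distrib-+ (x ∷ xs) g h =
    trans (cong ((g x + h x) +_) (∑-distrib-+ xs g h)) (interchange (g x) (h x) (∑ xs g) (∑ xs h))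

  ∑-distribʳ-* : ∀ (xs : List A) (g : A → ℕ) n → ∑[ x ∈ xs ] (g x * n) ≡ ∑ xs g * n
  ∑-distribʳ-* []       g n = refl
  ∑-distribʳ-* (x ∷ xs) g n =
    trans (cong (g x * n +_) (∑-distribʳ-* xs g n)) (sym (*-distribʳ-+ n (g x) (∑ xs g)))

  ∑-++ : ∀ (xs ys : List A) g → ∑ (xs ++ ys) g ≡ ∑ xs g + ∑ ys g
  ∑-++ []       ys g = refl
  ∑-++ (x ∷ xs) ys g = trans (cong (g x +_) (∑-++ xs ys g)) (sym (+-assoc (g x) _ _))

  length-filter : ∀ {P : A → Set} (P? : ∀ x → Dec (P x)) (xs : List A) →
                  length (filter P? xs) ≡ ∑[ x ∈ xs ] 𝟙 (P? x)
  length-filter P? []       = refl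
  length-filter P? (x ∷ xs) with does (P? x)
  ... | true  = cong suc (length-filter P? xs)
  ... | false = length-filter P? xs

module _ {A B : Set} where

  ∑-map : ∀ (f : A → B) (xs : List A) g → ∑ (map f xs) g ≡ ∑ xs (g ∘ f)
  ∑-map f []       g = refl
  ∑-map f (x ∷ xs) g = cong (g (f x) +_) (∑-map f xs g)

  ∑-concatMap : ∀ (f : A → List B) (xs : List A) g →
                ∑ (concatMap f xs) g ≡ ∑[ x ∈ xs ] ∑ (f x) g
  ∑-concatMap f []       g = refl
  ∑-concatMap f (x ∷ xs) g =
    trans (∑-++ (f x) (concatMap f xs) g) (cong (∑ (f x) g +_) (∑-concatMap f xs g))

  ∑-swap : ∀ (xs : List A) (ys : List B) (g : A → B → ℕ) →
           ∑[ x ∈ xs ] ∑ ys (g x) ≡ ∑[ y ∈ ys ] ∑[ x ∈ xs ] g x y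
  ∑-swap []       ys g = sym (∑-zero ys)
  ∑-swap (x ∷ xs) ys g =
    trans (cong (∑ ys (g x) +_) (∑-swap xs ys g)) (sym (∑-distrib-+ ys (g x) _))

-- Enumerating the functions Fin m → Color

_≗?_ : ∀ {m} (f h : Fin m → Color) → Dec (f ≗ h)
f ≗? h = all? (λ i → f i ≟ᶜ h i)

∑-allColors-≟ : ∀ y → ∑[ x ∈ allColors ] 𝟙 (x ≟ᶜ y) ≡ 1
∑-allColors-≟ red   = refl
∑-allColors-≟ green = refl
∑-allColors-≟ blue  = refl

𝟙-∷-≗ : ∀ {m} x (f : Fin m → Color) (h : Fin (suc m) → Color) →
        𝟙 ((x ∷ᵛ f) ≗? h) ≡ 𝟙 (x ≟ᶜ h zero) * 𝟙 (f ≗? (h ∘ suc))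
𝟙-∷-≗ x f h =
  trans (𝟙-⇔ ((x ∷ᵛ f) ≗? h) ((x ≟ᶜ h zero) ×-dec (f ≗? (h ∘ suc)))
          (λ x∷f≗h → x∷f≗h zero , x∷f≗h ∘ suc)
          (λ { (x≡h0 , f≗h∘suc) zero → x≡h0 ; (x≡h0 , f≗h∘suc) (suc i) → f≗h∘suc i }))
        (𝟙-×-dec (x ≟ᶜ h zero) (f ≗? (h ∘ suc)))

∑-allFuns-≗ : ∀ m (h : Fin m → Color) → ∑[ f ∈ allFuns m ] 𝟙 (f ≗? h) ≡ 1
∑-allFuns-≗ zero    h = refl
∑-allFuns-≗ (suc m) h = begin
  ∑[ f ∈ allFuns (suc m) ] 𝟙 (f ≗? h)
    ≡⟨ ∑-concatMap (λ f → map (_∷ᵛ f) allColors) (allFuns m) (λ g → 𝟙 (g ≗? h)) ⟩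
  ∑[ f ∈ allFuns m ] ∑ (map (_∷ᵛ f) allColors) (λ g → 𝟙 (g ≗? h))
    ≡⟨ ∑-cong (allFuns m) (λ f → ∑-map (_∷ᵛ f) allColors (λ g → 𝟙 (g ≗? h))) ⟩
  ∑[ f ∈ allFuns m ] ∑[ x ∈ allColors ] 𝟙 ((x ∷ᵛ f) ≗? h)
    ≡⟨ ∑-cong (allFuns m) (λ f → ∑-cong allColors (λ x → 𝟙-∷-≗ x f h)) ⟩
  ∑[ f ∈ allFuns m ] ∑[ x ∈ allColors ] (𝟙 (x ≟ᶜ h zero) * 𝟙 (f ≗? (h ∘ suc)))
    ≡⟨ ∑-cong (allFuns m) (λ f → ∑-distribʳ-* allColors (λ x → 𝟙 (x ≟ᶜ h zero)) (𝟙 (f ≗? (h ∘ suc)))) ⟩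
  ∑[ f ∈ allFuns m ] (∑[ x ∈ allColors ] 𝟙 (x ≟ᶜ h zero) * 𝟙 (f ≗? (h ∘ suc)))
    ≡⟨ ∑-cong (allFuns m) (λ f → cong (_* 𝟙 (f ≗? (h ∘ suc))) (∑-allColors-≟ (h zero))) ⟩
  ∑[ f ∈ allFuns m ] (1 * 𝟙 (f ≗? (h ∘ suc)))
    ≡⟨ ∑-cong (allFuns m) (λ f → *-identityˡ _) ⟩
  ∑[ f ∈ allFuns m ] 𝟙 (f ≗? (h ∘ suc))
    ≡⟨ ∑-allFuns-≗ m (h ∘ suc) ⟩
  1 ∎
  where open ≡-Reasoning

module _ {m : ℕ} {g : (Fin m → Color) → ℕ} (g-cong : g Preserves _≗_ ⟶ _≡_) where

  ∑-allFuns-select : ∀ k → ∑[ h ∈ allFuns m ] (𝟙 (k ≗? h) * g h) ≡ g k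
  ∑-allFuns-select k = begin
    ∑[ h ∈ allFuns m ] (𝟙 (k ≗? h) * g h)
      ≡⟨ ∑-cong (allFuns m) (λ h → 𝟙-*-cong (k ≗? h) (λ k≗h → g-cong (sym ∘ k≗h))) ⟩
    ∑[ h ∈ allFuns m ] (𝟙 (k ≗? h) * g k)
      ≡⟨ ∑-distribʳ-* (allFuns m) (λ h → 𝟙 (k ≗? h)) (g k) ⟩
    ∑[ h ∈ allFuns m ] 𝟙 (k ≗? h) * g k
      ≡⟨ cong (_* g k) (∑-cong (allFuns m) (λ h → 𝟙-⇔ (k ≗? h) (h ≗? k) (sym ∘_) (sym ∘_))) ⟩
    ∑[ h ∈ allFuns m ] 𝟙 (h ≗? k) * g k
      ≡⟨ cong (_* g k) (∑-allFuns-≗ m k) ⟩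
    1 * g k
      ≡⟨ *-identityˡ (g k) ⟩
    g k ∎
    where open ≡-Reasoning

  -- Double counting: each h is hit by exactly one f with f ∘ σ ≗ h, namely f = h ∘ π.
  ∑-allFuns-∘ : ∀ (σ π : Fin m → Fin m) → σ ∘ π ≗ id → π ∘ σ ≗ id →
                ∑[ f ∈ allFuns m ] g (f ∘ σ) ≡ ∑ (allFuns m) g
  ∑-allFuns-∘ σ π σπ πσ = begin
    ∑[ f ∈ allFuns m ] g (f ∘ σ)
      ≡⟨ ∑-cong (allFuns m) (∑-allFuns-select ∘ (_∘ σ)) ⟨
    ∑[ f ∈ allFuns m ] ∑[ h ∈ allFuns m ] (𝟙 ((f ∘ σ) ≗? h) * g h)
      ≡⟨ ∑-swap (allFuns m) (allFuns m) (λ f h → 𝟙 ((f ∘ σ) ≗? h) * g h) ⟩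
    ∑[ h ∈ allFuns m ] ∑[ f ∈ allFuns m ] (𝟙 ((f ∘ σ) ≗? h) * g h)
      ≡⟨ ∑-cong (allFuns m) (λ h → ∑-distribʳ-* (allFuns m) (λ f → 𝟙 ((f ∘ σ) ≗? h)) (g h)) ⟩
    ∑[ h ∈ allFuns m ] (∑[ f ∈ allFuns m ] 𝟙 ((f ∘ σ) ≗? h) * g h)
      ≡⟨ ∑-cong (allFuns m) (λ h → cong (_* g h) (∑-cong (allFuns m) (𝟙-∘σ-≗ h))) ⟩
    ∑[ h ∈ allFuns m ] (∑[ f ∈ allFuns m ] 𝟙 (f ≗? (h ∘ π)) * g h)
      ≡⟨ ∑-cong (allFuns m) (λ h → cong (_* g h) (∑-allFuns-≗ m (h ∘ π))) ⟩
    ∑[ h ∈ allFuns m ] (1 * g h)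
      ≡⟨ ∑-cong (allFuns m) (λ h → *-identityˡ (g h)) ⟩
    ∑ (allFuns m) g ∎
    where
    open ≡-Reasoning
    𝟙-∘σ-≗ : ∀ h f → 𝟙 ((f ∘ σ) ≗? h) ≡ 𝟙 (f ≗? (h ∘ π))
    𝟙-∘σ-≗ h f = 𝟙-⇔ ((f ∘ σ) ≗? h) (f ≗? (h ∘ π))
      (λ f∘σ≗h i → trans (cong f (sym (σπ i))) (f∘σ≗h (π i)))
      (λ f≗h∘π i → trans (f≗h∘π (σ i)) (cong h (πσ i)))

-- Relabelling the vertices

-- If π missed i it would inject Fin (suc n) into Fin n.
injective⇒onto : ∀ {n} {π : Fin n → Fin n} → Injective _≡_ _≡_ π → ∀ i → ∃ λ j → π j ≡ i
injective⇒onto {suc n} {π} π-inj i with any? (λ j → π j ≟ᶠ i)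
... | yes hit = hit
... | no miss
  with j , k , j<k , eq ← pigeonhole (n<1+n n) (λ j → punchOut (miss ∘ (j ,_) ∘ sym))
  = ⊥-elim (<⇒≢ j<k (π-inj (punchOut-injective (miss ∘ (j ,_) ∘ sym) (miss ∘ (k ,_) ∘ sym) eq)))

AgreeOffDiagonal : ∀ {m} → Coloring m → Coloring m → Set
AgreeOffDiagonal {m} c c′ = ∀ (i j : Fin m) → i ≢ j → c i j ≡ c′ i j

IsGallai-resp : ∀ {m} {c c′ : Coloring m} → AgreeOffDiagonal c c′ → IsGallai c → IsGallai c′
IsGallai-resp c≈c′ G i j k i≢j j≢k i≢k
  rewrite sym (c≈c′ i j i≢j) | sym (c≈c′ j k j≢k) | sym (c≈c′ i k i≢k) = G i j k i≢j j≢k i≢k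

IsGallai-on : ∀ {n m} {ρ : Fin n → Fin m} (c : Coloring m) → Injective _≡_ _≡_ ρ →
              IsGallai c → IsGallai (c on ρ)
IsGallai-on c ρ-inj G i j k i≢j j≢k i≢k = G _ _ _ (i≢j ∘ ρ-inj) (j≢k ∘ ρ-inj) (i≢k ∘ ρ-inj)

IsGallai-on⁻¹ : ∀ {n m} {ρ : Fin n → Fin m} (c : Coloring m) → (∀ i → ∃ λ j → ρ j ≡ i) →
                IsGallai (c on ρ) → IsGallai c
IsGallai-on⁻¹ {ρ = ρ} c ρ-onto G i j k i≢j j≢k i≢k
  with i′ , refl ← ρ-onto i | j′ , refl ← ρ-onto j | k′ , refl ← ρ-onto k
  = G i′ j′ k′ (i≢j ∘ cong ρ) (j≢k ∘ cong ρ) (i≢k ∘ cong ρ)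

𝟙-isGallai-cong : ∀ {m} {c c′ : Coloring m} → AgreeOffDiagonal c c′ →
                  𝟙 (isGallai? c) ≡ 𝟙 (isGallai? c′)
𝟙-isGallai-cong c≈c′ = 𝟙-⇔ (isGallai? _) (isGallai? _)
  (IsGallai-resp c≈c′) (IsGallai-resp (λ i j i≢j → sym (c≈c′ i j i≢j)))

𝟙-isGallai-on : ∀ {m} {ρ : Fin m → Fin m} (c : Coloring m) → Injective _≡_ _≡_ ρ →
                𝟙 (isGallai? (c on ρ)) ≡ 𝟙 (isGallai? c)
𝟙-isGallai-on c ρ-inj = 𝟙-⇔ (isGallai? _) (isGallai? _)
  (IsGallai-on⁻¹ c (injective⇒onto ρ-inj)) (IsGallai-on c ρ-inj)

extend-cong : ∀ {m} {c c′ : Coloring m} {f f′ : Fin m → Color} →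
              AgreeOffDiagonal c c′ → f ≗ f′ → AgreeOffDiagonal (extend c f) (extend c′ f′)
extend-cong c≈c′ f≗f′ zero    zero    0≢0 = ⊥-elim (0≢0 refl)
extend-cong c≈c′ f≗f′ zero    (suc j) _   = f≗f′ j
extend-cong c≈c′ f≗f′ (suc i) zero    _   = f≗f′ i
extend-cong c≈c′ f≗f′ (suc i) (suc j) i≢j = c≈c′ i j (i≢j ∘ cong suc)

w≡∑ : ∀ {m} (c : Coloring m) → w c ≡ ∑[ f ∈ allFuns m ] 𝟙 (isGallai? (extend c f))
w≡∑ {m} c = length-filter (λ f → isGallai? (extend c f)) (allFuns m)

w-cong : ∀ {m} {c c′ : Coloring m} → AgreeOffDiagonal c c′ → w c ≡ w c′
w-cong {m} {c} {c′} c≈c′ = begin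
  w c                                              ≡⟨ w≡∑ c ⟩
  ∑[ f ∈ allFuns m ] 𝟙 (isGallai? (extend c f))    ≡⟨ ∑-cong (allFuns m) (λ f → 𝟙-isGallai-cong (extend-cong c≈c′ λ _ → refl)) ⟩
  ∑[ f ∈ allFuns m ] 𝟙 (isGallai? (extend c′ f))   ≡⟨ w≡∑ c′ ⟨
  w c′                                             ∎
  where open ≡-Reasoning

w-on : ∀ {m} {π : Fin m → Fin m} (c : Coloring m) → Injective _≡_ _≡_ π → w (c on π) ≡ w c
w-on {m} {π} c π-inj = begin
  w (c on π)                                             ≡⟨ w≡∑ (c on π) ⟩
  ∑[ f ∈ allFuns m ] 𝟙 (isGallai? (extend (c on π) f))   ≡⟨ ∑-cong (allFuns m) 𝟙-relabel ⟩
  ∑[ f ∈ allFuns m ] 𝟙 (isGallai? (extend c (f ∘ σ)))    ≡⟨ ∑-allFuns-∘ extensional σ π σπ πσ ⟩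
  ∑[ f ∈ allFuns m ] 𝟙 (isGallai? (extend c f))          ≡⟨ w≡∑ c ⟨
  w c                                                    ∎
  where
  open ≡-Reasoning
  σ : Fin m → Fin m
  σ = proj₁ ∘ injective⇒onto π-inj
  πσ : π ∘ σ ≗ id
  πσ = proj₂ ∘ injective⇒onto π-inj
  σπ : σ ∘ π ≗ id
  σπ i = π-inj (πσ (π i))
  extensional : (λ f → 𝟙 (isGallai? (extend c f))) Preserves _≗_ ⟶ _≡_
  extensional f≗f′ = 𝟙-isGallai-cong (extend-cong (λ _ _ _ → refl) f≗f′)
  extend-on : ∀ f → AgreeOffDiagonal (extend (c on π) f) (extend c (f ∘ σ) on lift 1 π)
  extend-on f zero    zero    _ = refl
  extend-on f zero    (suc j) _ = cong f (sym (σπ j))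
  extend-on f (suc i) zero    _ = cong f (sym (σπ i))
  extend-on f (suc i) (suc j) _ = refl
  𝟙-relabel : ∀ f → 𝟙 (isGallai? (extend (c on π) f)) ≡ 𝟙 (isGallai? (extend c (f ∘ σ)))
  𝟙-relabel f = trans (𝟙-isGallai-cong {c = extend (c on π) f} {c′ = extend c (f ∘ σ) on lift 1 π} (extend-on f))
                      (𝟙-isGallai-on {ρ = lift 1 π} (extend c (f ∘ σ)) (lift-injective π π-inj 1))

-- The standard colouring of a matching

-- Vertex (k , s) of K_{2n} is endpoint s of the k-th matching edge.
pairColoring : ∀ {n} → (Fin n → Color) → Color → Fin n × Fin 2 → Fin n × Fin 2 → Color
pairColoring c γ (k , _) (l , _) = if does (k ≟ᶠ l) then c k else γ

pairOf : Fin 6 → Fin 3 × Fin 2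
pairOf zero                               = zero           , zero
pairOf (suc zero)                         = zero           , suc zero
pairOf (suc (suc zero))                   = suc zero       , zero
pairOf (suc (suc (suc zero)))             = suc zero       , suc zero
pairOf (suc (suc (suc (suc zero))))       = suc (suc zero) , zero
pairOf (suc (suc (suc (suc (suc zero))))) = suc (suc zero) , suc zero

combine-pairOf : ∀ i → uncurry combine (pairOf i) ≡ i
combine-pairOf zero                               = refl
combine-pairOf (suc zero)                         = refl
combine-pairOf (suc (suc zero))                   = refl
combine-pairOf (suc (suc (suc zero)))             = refl
combine-pairOf (suc (suc (suc (suc zero))))       = refl
combine-pairOf (suc (suc (suc (suc (suc zero))))) = refl

pairOf-injective : Injective _≡_ _≡_ pairOf
pairOf-injective {i} {j} eq = begin
  i                           ≡⟨ combine-pairOf i ⟨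
  uncurry combine (pairOf i)  ≡⟨ cong (uncurry combine) eq ⟩
  uncurry combine (pairOf j)  ≡⟨ combine-pairOf j ⟩
  j                           ∎
  where open ≡-Reasoning

standardColoring : (Fin 3 → Color) → Color → Coloring 6
standardColoring c γ = pairColoring c γ on pairOf

pairColoring-cong : ∀ {n} {c c′ : Fin n → Color} γ → c ≗ c′ → ∀ p q → pairColoring c γ p q ≡ pairColoring c′ γ p q
pairColoring-cong γ c≗c′ (k , _) (l , _) with k ≟ᶠ l
... | yes _ = c≗c′ k
... | no  _ = refl

standardColoring-cong : ∀ {c c′} γ → c ≗ c′ → AgreeOffDiagonal (standardColoring c γ) (standardColoring c′ γ)
standardColoring-cong γ c≗c′ i j _ = pairColoring-cong γ c≗c′ (pairOf i) (pairOf j)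

Admissible : (Fin 3 → Color) → Color → Set
Admissible c γ = (∀ k → c k ≢ γ) × (∃₂ λ k l → c k ≢ c l)

admissible? : ∀ c γ → Dec (Admissible c γ)
admissible? c γ = all? (λ k → ¬? (c k ≟ᶜ γ)) ×-dec any? (λ k → any? (λ l → ¬? (c k ≟ᶜ c l)))

Admissible-cong : ∀ {c c′} γ → c ≗ c′ → Admissible c γ → Admissible c′ γ
Admissible-cong γ c≗c′ (c≢γ , k , l , ck≢cl) =
    (λ k → c≢γ k ∘ trans (c≗c′ k))
  , k , l , (λ e → ck≢cl (trans (c≗c′ k) (trans e (sym (c≗c′ l)))))

∀-Color? : ∀ {P : Color → Set} → (∀ x → Dec (P x)) → Dec (∀ x → P x)
∀-Color? P? = map′ (λ { (r , g , b) red → r ; (r , g , b) green → g ; (r , g , b) blue → b })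
                   (λ all → all red , all green , all blue)
                   (P? red ×-dec P? green ×-dec P? blue)

-- `invert (proof d)` has type `if does d then _ else _`, so this checks by evaluating
-- `does d`; the implication only evaluates w for admissible colourings.
w-standardColoring-table : ∀ c₀ c₁ c₂ γ → let c = c₀ ∷ᵛ c₁ ∷ᵛ c₂ ∷ᵛ []ᵛ in
                           Admissible c γ → w (standardColoring c γ) ≡ 53
w-standardColoring-table = invert (proof (
  ∀-Color? λ c₀ → ∀-Color? λ c₁ → ∀-Color? λ c₂ → ∀-Color? λ γ →
  let c = c₀ ∷ᵛ c₁ ∷ᵛ c₂ ∷ᵛ []ᵛ in admissible? c γ →-dec (w (standardColoring c γ) ≟ⁿ 53)))

w-standardColoring : ∀ c γ → Admissible c γ → w (standardColoring c γ) ≡ 53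
w-standardColoring c γ adm = begin
  w (standardColoring c γ)  ≡⟨ w-cong {c = standardColoring c γ} {standardColoring c′ γ} (standardColoring-cong γ c≗c′) ⟩
  w (standardColoring c′ γ) ≡⟨ w-standardColoring-table (c zero) (c (suc zero)) (c (suc (suc zero))) γ
                                 (Admissible-cong γ c≗c′ adm) ⟩
  53                        ∎
  where
  open ≡-Reasoning
  c′ : Fin 3 → Color
  c′ = c zero ∷ᵛ c (suc zero) ∷ᵛ c (suc (suc zero)) ∷ᵛ []ᵛ
  c≗c′ : c ≗ c′
  c≗c′ zero                = refl
  c≗c′ (suc zero)          = refl
  c≗c′ (suc (suc zero))    = refl

module _ (M : Matching3) where
  open Matching3 M

  endpoint : Fin 3 × Fin 2 → Fin 6
  endpoint (k , zero)     = a k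
  endpoint (k , suc zero) = b k

  endpoint-injective : Injective _≡_ _≡_ endpoint
  endpoint-injective {k , zero}     {l , zero}     ak≡al = cong (_, zero) (a-inj k l ak≡al)
  endpoint-injective {k , zero}     {l , suc zero} ak≡bl = ⊥-elim (a≢b k l ak≡bl)
  endpoint-injective {k , suc zero} {l , zero}     bk≡al = ⊥-elim (a≢b l k (sym bk≡al))
  endpoint-injective {k , suc zero} {l , suc zero} bk≡bl = cong (_, suc zero) (b-inj k l bk≡bl)

  InMatching-endpoint : ∀ p q → InMatching M (endpoint p) (endpoint q) → proj₁ p ≡ proj₁ q
  InMatching-endpoint p q (k , inj₁ (p≡ak , q≡bk)) =
    trans (cong proj₁ (endpoint-injective {p} {k , zero} p≡ak))
          (sym (cong proj₁ (endpoint-injective {q} {k , suc zero} q≡bk)))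
  InMatching-endpoint p q (k , inj₂ (p≡bk , q≡ak)) =
    trans (cong proj₁ (endpoint-injective {p} {k , suc zero} p≡bk))
          (sym (cong proj₁ (endpoint-injective {q} {k , zero} q≡ak)))

  matchingOrder : Fin 6 → Fin 6
  matchingOrder = endpoint ∘ pairOf

  matchingOrder-injective : Injective _≡_ _≡_ matchingOrder
  matchingOrder-injective = pairOf-injective ∘ endpoint-injective

  matchingColors : Coloring 6 → Fin 3 → Color
  matchingColors φ k = φ (a k) (b k)

  module _ (φ : Coloring 6) (φ-sym : Symmetric φ) (γ : Color)
           (φ-off : ∀ i j → i ≢ j → ¬ InMatching M i j → φ i j ≡ γ) where

    φ-endpoint : ∀ p q → p ≢ q → φ (endpoint p) (endpoint q) ≡ pairColoring (matchingColors φ) γ p q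
    φ-endpoint (k , s) (l , t) p≢q with k ≟ᶠ l
    ... | no k≢l = φ-off _ _ (p≢q ∘ endpoint-injective) (k≢l ∘ InMatching-endpoint (k , s) (l , t))
    φ-endpoint (k , zero)     (_ , zero)     p≢q | yes refl = ⊥-elim (p≢q refl)
    φ-endpoint (k , zero)     (_ , suc zero) p≢q | yes refl = refl
    φ-endpoint (k , suc zero) (_ , zero)     p≢q | yes refl = φ-sym (b k) (a k) (a≢b k k ∘ sym)
    φ-endpoint (k , suc zero) (_ , suc zero) p≢q | yes refl = ⊥-elim (p≢q refl)

    φ-on-matchingOrder : AgreeOffDiagonal (φ on matchingOrder) (standardColoring (matchingColors φ) γ)
    φ-on-matchingOrder i j i≢j =
      φ-endpoint (pairOf i) (pairOf j) (i≢j ∘ pairOf-injective)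

-- The Gallai and three-colour hypotheses are implied by the matching hypothesis.
lemma4p7 : (φ : Coloring 6) → Symmetric φ → IsGallai φ → UsesAllThreeColors φ →
    MatchingColoring φ → w φ ≡ 53
-- The colourings in the w-cong and w-on steps are given explicitly: inferring them by
-- unification makes Agda unfold w.
lemma4p7 φ φ-sym _ _ (M , α , β , γ , (α≢β , β≢γ , α≢γ) , αβ , (kα , eα) , (kβ , eβ) , φ-off) = begin
  w φ                       ≡⟨ w-on {π = matchingOrder M} φ (matchingOrder-injective M) ⟨
  w (φ on matchingOrder M)  ≡⟨ w-cong {c = φ on matchingOrder M} {standardColoring c γ} (φ-on-matchingOrder M φ φ-sym γ φ-off) ⟩
  w (standardColoring c γ)  ≡⟨ w-standardColoring c γ (c≢γ , kα , kβ , α≢β ∘ cα≡cβ) ⟩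
  53                        ∎
  where
  open ≡-Reasoning
  c : Fin 3 → Color
  c = matchingColors M φ
  c≢γ : ∀ k → c k ≢ γ
  c≢γ k with αβ k
  ... | inj₁ ck≡α = α≢γ ∘ trans (sym ck≡α)
  ... | inj₂ ck≡β = β≢γ ∘ trans (sym ck≡β)
  cα≡cβ : c kα ≡ c kβ → α ≡ β
  cα≡cβ e = trans (sym eα) (trans e eβ)
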